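{- Let $G=Q_h(X)$ be a daisy cube and $H$ a $\le$-subgraph of $G$. Then the $\le$-expansion of $G$ with respect to $H$, i.e. the peripheral expansion $\mathrm{pe}(G;V(H))$, is (isomorphic to) a daisy cube.
   Context: $B=\{0,1\}$; $Q_h$ has vertex set $B^h$ (binary strings of length $h$), two strings adjacent iff they differ in exactly one position. For $u,v\in B^h$ write $u\le v$ if $u_i\le v_i$ for all $i$. For $X\subseteq B^h$ the daisy cube $Q_h(X)$ is the subgraph of $Q_h$ induced by $\{u: u\le x\text{ for some } x\in X\}$; a graph is a daisy cube if isomorphic to some such $Q_m(Y)$. An induced subgraph $H$ of a daisy cube $G$ is a $\le$-subgraph if $V(H)=\{u\in V(G): u\le v\text{ for some }v\in V(H)\}$. For $S\subseteq V(G)$, the peripheral expansion $\mathrm{pe}(G;S)$ is the graph obtained from $G$ by adding a new vertex $v'$ for each $v\in S$, the edge $vv'$ for each $v\in S$, and the edge $u'v'$ for each edge $uv\in E(G)$ with $u,v\in S$. When $H$ is a $\le$-subgraph, $\mathrm{pe}(G;V(H))$ is called the $\le$-expansion of $G$ with respect to $H$. -}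

module Defs where

open import Data.Bool using (Bool; true; false; T; _∧_; _∨_; not)
open import Data.Nat using (ℕ; zero; suc; _+_)
open import Data.Vec using (Vec; []; _∷_)
open import Data.List using (List)
open import Data.List.Relation.Unary.Any using (Any)
open import Data.Product using (Σ; ∃; ∃-syntax; _×_; _,_; proj₁)
open import Data.Sum using (_⊎_; inj₁; inj₂)
open import Data.Empty using (⊥)
open import Data.Unit using (⊤)
open import Relation.Binary.PropositionalEquality using (_≡_)
open import Function.Bundles using (_↔_; _⇔_; Inverse)
open import Level using (0ℓ)

record Graph : Set₁ where
  field
    V   : Set
    Adj : V → V → Set
open Graph public

_≅_ : Graph → Graph → Set
G ≅ H = Σ (V G ↔ V H) λ f →
  ∀ a b → Adj G a b ⇔ Adj H (Inverse.to f a) (Inverse.to f b)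

B^ : ℕ → Set
B^ h = Vec Bool h

leqB : Bool → Bool → Bool
leqB true  false = false
leqB _     _     = true

_≤ᵇ_ : ∀ {h} → B^ h → B^ h → Bool
[]       ≤ᵇ []       = true
(a ∷ u)  ≤ᵇ (b ∷ v)  = leqB a b ∧ (u ≤ᵇ v)

_≼_ : ∀ {h} → B^ h → B^ h → Set
u ≼ v = T (u ≤ᵇ v)

xorB : Bool → Bool → Bool
xorB true  true  = false
xorB false false = false
xorB _     _     = true

toℕ : Bool → ℕ
toℕ true  = 1
toℕ false = 0

hamming : ∀ {h} → B^ h → B^ h → ℕ
hamming []      []      = 0
hamming (a ∷ u) (b ∷ v) = toℕ (xorB a b) + hamming u v

QAdj : ∀ {h} → B^ h → B^ h → Set
QAdj u v = hamming u v ≡ 1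

belowSome : ∀ {h} → B^ h → List (B^ h) → Bool
belowSome u List.[] = false
belowSome u (x List.∷ X) = (u ≤ᵇ x) ∨ belowSome u X

-- The daisy cube Q_h(X): induced subgraph of Q_h on {u : u ≤ x for some x ∈ X}.
-- (The membership proof is T of a Boolean, hence proof-irrelevant.)
Daisy : (h : ℕ) → List (B^ h) → Graph
Daisy h X = record
  { V   = Σ (B^ h) (λ u → T (belowSome u X))
  ; Adj = λ u v → QAdj (proj₁ u) (proj₁ v)
  }

IsDaisyCube : Graph → Set
IsDaisyCube G = ∃[ m ] ∃[ Y ] (G ≅ Daisy m Y)

-- Peripheral expansion pe(G;S), S ⊆ V(G) given by a Boolean predicate.
-- Vertices: old vertices inj₁ v, new vertices inj₂ (v , _) = v' for v ∈ S.
peAdj : (G : Graph) (S : V G → Bool) →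
        (V G ⊎ Σ (V G) (λ v → T (S v))) → (V G ⊎ Σ (V G) (λ v → T (S v))) → Set
peAdj G S (inj₁ u)       (inj₁ v)       = Adj G u v
peAdj G S (inj₁ u)       (inj₂ (v , _)) = u ≡ v
peAdj G S (inj₂ (u , _)) (inj₁ v)       = u ≡ v
peAdj G S (inj₂ (u , _)) (inj₂ (v , _)) = Adj G u v

pe : (G : Graph) → (V G → Bool) → Graph
pe G S = record
  { V   = V G ⊎ Σ (V G) (λ v → T (S v))
  ; Adj = peAdj G S
  }

-- H (given by its vertex set S ⊆ V(Q_h(X))) is a ≤-subgraph of Q_h(X):
-- V(H) = {u ∈ V(G) : u ≤ v for some v ∈ V(H)}, i.e. V(H) is down-closed in V(G).
-- (The inclusion ⊆ is automatic by reflexivity of ≤.)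
Is≤Subgraph : (h : ℕ) (X : List (B^ h)) → (V (Daisy h X) → Bool) → Set
Is≤Subgraph h X S =
  ∀ (u : V (Daisy h X)) →
    T (S u) ⇔ (∃[ v ] (T (S v) × (proj₁ u ≼ proj₁ v)))

-- Let G = Q_h(X) and let S be the vertex set of a ≤-subgraph H of G.  Put
--     Z = V(H)   (listed by filtering an enumeration of all of B^h),
--     Y = 0X ∪ 1Z ⊆ B^(h+1).
-- We show pe(G; S) ≅ Q_{h+1}(Y) via  v ↦ 0v  and  v' ↦ 1v.
--   * 0u lies below Y  iff  u lies below X or below Z  iff  u ∈ V(G),
--     because every element of Z is a vertex of G and V(G) is down-closed.
--   * 1u lies below Y  iff  u lies below Z  iff  u ∈ V(H),
--     because V(H) is down-closed in G (the ≤-subgraph hypothesis).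
--   * Hamming distance splits as (first bit) + (rest), so 0u ~ 0v and
--     1u ~ 1v iff u ~ v, while 0u ~ 1v iff u = v: exactly the edges of pe.

module Submission where

open import Defs
open import Data.Nat using (ℕ; zero; suc)
open import Data.Nat.Properties using (suc-injective)
open import Data.Bool using (Bool; true; false; T; T?; _∧_; _∨_)
open import Data.Bool.Properties using (T-∨; T-irrelevant; ∨-assoc; ∧-distribˡ-∨; ∧-zeroʳ)
open import Data.List using (List; []; _∷_; map; _++_; filterᵇ)
open import Data.List.Membership.Propositional using (_∈_)
open import Data.List.Membership.Propositional.Properties
  using (∈-map⁺; ∈-++⁺ˡ; ∈-++⁺ʳ; ∈-filter⁺; ∈-filter⁻)
open import Data.List.Relation.Unary.Any using (here; there)
open import Data.Vec using () renaming ([] to []ᵥ; _∷_ to _∷ᵥ_)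
open import Data.Product using (Σ; ∃-syntax; _×_; _,_; proj₁; proj₂)
open import Data.Sum using (inj₁; inj₂)
open import Data.Unit using (tt)
open import Relation.Binary.PropositionalEquality using (_≡_; refl; cong; cong₂; sym; subst; module ≡-Reasoning)
open import Function using (_∘_)
open import Function.Bundles using (_↔_; _⇔_; Equivalence; mk↔ₛ′; mk⇔)

-- Elements of a subset {a : T (P a)} are determined by their underlying
-- element, since T b has at most one proof.  Both the vertices of a daisy
-- cube and the vertices of H are of this form.
Σ-T-≡ : {A : Set} {P : A → Bool} {a b : Σ A (λ x → T (P x))} →
        proj₁ a ≡ proj₁ b → a ≡ b
Σ-T-≡ {a = x , p} {b = .x , q} refl = cong (x ,_) (T-irrelevant p q)

≼-refl : ∀ {h} (u : B^ h) → u ≼ u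
≼-refl []ᵥ          = tt
≼-refl (false ∷ᵥ u) = ≼-refl u
≼-refl (true ∷ᵥ u)  = ≼-refl u

≼-trans : ∀ {h} (u v w : B^ h) → u ≼ v → v ≼ w → u ≼ w
≼-trans []ᵥ          []ᵥ          []ᵥ          _  _  = tt
≼-trans (false ∷ᵥ u) (false ∷ᵥ v) (false ∷ᵥ w) p  q  = ≼-trans u v w p q
≼-trans (false ∷ᵥ u) (false ∷ᵥ v) (true ∷ᵥ w)  p  q  = ≼-trans u v w p q
≼-trans (false ∷ᵥ u) (true ∷ᵥ v)  (true ∷ᵥ w)  p  q  = ≼-trans u v w p q
≼-trans (true ∷ᵥ u)  (true ∷ᵥ v)  (true ∷ᵥ w)  p  q  = ≼-trans u v w p q
≼-trans (false ∷ᵥ u) (true ∷ᵥ v)  (false ∷ᵥ w) _  ()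
≼-trans (true ∷ᵥ u)  (true ∷ᵥ v)  (false ∷ᵥ w) _  ()
≼-trans (true ∷ᵥ u)  (false ∷ᵥ v) _            () _

-- Hamming distance 0 characterises equality; this is what makes the
-- "rung" edges v v' of the expansion correspond to edges 0v ~ 1v.
hamming-self : ∀ {h} (u : B^ h) → hamming u u ≡ 0
hamming-self []ᵥ          = refl
hamming-self (false ∷ᵥ u) = hamming-self u
hamming-self (true ∷ᵥ u)  = hamming-self u

hamming-zero : ∀ {h} (u v : B^ h) → hamming u v ≡ 0 → u ≡ v
hamming-zero []ᵥ          []ᵥ          _  = refl
hamming-zero (false ∷ᵥ u) (false ∷ᵥ v) e  = cong (false ∷ᵥ_) (hamming-zero u v e)
hamming-zero (true ∷ᵥ u)  (true ∷ᵥ v)  e  = cong (true ∷ᵥ_) (hamming-zero u v e)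
hamming-zero (false ∷ᵥ u) (true ∷ᵥ v)  ()
hamming-zero (true ∷ᵥ u)  (false ∷ᵥ v) ()

daisy-≡⇔hamming-zero : ∀ {h X} (a b : V (Daisy h X)) →
                       a ≡ b ⇔ hamming (proj₁ a) (proj₁ b) ≡ 0
daisy-≡⇔hamming-zero (u , _) (v , _) =
  mk⇔ (λ { refl → hamming-self u }) (λ e → Σ-T-≡ (hamming-zero u v e))

belowSome⇔ : ∀ {h} (u : B^ h) (L : List (B^ h)) →
             T (belowSome u L) ⇔ (∃[ x ] x ∈ L × u ≼ x)
belowSome⇔ u []      = mk⇔ (λ ()) (λ { (_ , () , _) })
belowSome⇔ u (x ∷ L) = mk⇔ to from
  where
  to : T (belowSome u (x ∷ L)) → ∃[ y ] y ∈ x ∷ L × u ≼ y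
  to p with Equivalence.to (T-∨ {u ≤ᵇ x}) p
  ... | inj₁ u≼x = x , here refl , u≼x
  ... | inj₂ q   = let y , y∈L , u≼y = Equivalence.to (belowSome⇔ u L) q
                   in y , there y∈L , u≼y
  from : (∃[ y ] y ∈ x ∷ L × u ≼ y) → T (belowSome u (x ∷ L))
  from (_ , here refl , u≼x) = Equivalence.from (T-∨ {u ≤ᵇ x}) (inj₁ u≼x)
  from (y , there y∈L , u≼y) =
    Equivalence.from (T-∨ {u ≤ᵇ x}) (inj₂ (Equivalence.from (belowSome⇔ u L) (y , y∈L , u≼y)))

belowSome-downward : ∀ {h} (u s : B^ h) (L : List (B^ h)) →
                     u ≼ s → T (belowSome s L) → T (belowSome u L)
belowSome-downward u s L u≼s p =
  let x , x∈L , s≼x = Equivalence.to (belowSome⇔ s L) p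
  in Equivalence.from (belowSome⇔ u L) (x , x∈L , ≼-trans u s x u≼s s≼x)

belowSome-++ : ∀ {h} (u : B^ h) (L M : List (B^ h)) →
               belowSome u (L ++ M) ≡ belowSome u L ∨ belowSome u M
belowSome-++ u []      M = refl
belowSome-++ u (x ∷ L) M rewrite belowSome-++ u L M = sym (∨-assoc (u ≤ᵇ x) (belowSome u L) (belowSome u M))

belowSome-prefix : ∀ {h} (a b : Bool) (u : B^ h) (L : List (B^ h)) →
                   belowSome (a ∷ᵥ u) (map (b ∷ᵥ_) L) ≡ leqB a b ∧ belowSome u L
belowSome-prefix a b u []      = sym (∧-zeroʳ (leqB a b))
belowSome-prefix a b u (x ∷ L) rewrite belowSome-prefix a b u L =
  sym (∧-distribˡ-∨ (leqB a b) (u ≤ᵇ x) (belowSome u L))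

-- An explicit enumeration of all of B^h, so that any subset of B^h given
-- by a Boolean test can be listed by filtering it.
allStrings : (h : ℕ) → List (B^ h)
allStrings zero    = []ᵥ ∷ []
allStrings (suc h) = map (false ∷ᵥ_) (allStrings h) ++ map (true ∷ᵥ_) (allStrings h)

allStrings-complete : ∀ {h} (u : B^ h) → u ∈ allStrings h
allStrings-complete []ᵥ          = here refl
allStrings-complete (false ∷ᵥ u) = ∈-++⁺ˡ (∈-map⁺ (false ∷ᵥ_) (allStrings-complete u))
allStrings-complete {suc h} (true ∷ᵥ u) =
  ∈-++⁺ʳ (map (false ∷ᵥ_) (allStrings h)) (∈-map⁺ (true ∷ᵥ_) (allStrings-complete u))

-- A Boolean test whose second part may use a proof of the first; this
-- turns the predicate S, defined only on vertices of G, into a test on B^h.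
guarded : (b : Bool) → (T b → Bool) → Bool
guarded true  f = f tt
guarded false _ = false

T-guarded : ∀ {b} {f : T b → Bool} → T (guarded b f) ⇔ Σ (T b) (λ p → T (f p))
T-guarded {true}  = mk⇔ (λ q → tt , q) proj₂
T-guarded {false} = mk⇔ (λ ()) (λ ())

module Expansion (h : ℕ) (X : List (B^ h)) (S : V (Daisy h X) → Bool)
                 (isSub : Is≤Subgraph h X S) where

  G : Graph
  G = Daisy h X

  inH : B^ h → Bool
  inH u = guarded (belowSome u X) (λ p → S (u , p))

  Z : List (B^ h)
  Z = filterᵇ inH (allStrings h)

  Y : List (B^ (suc h))
  Y = map (false ∷ᵥ_) X ++ map (true ∷ᵥ_) Z

  ∈Z⇔inH : (u : B^ h) → u ∈ Z ⇔ T (inH u)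
  ∈Z⇔inH u = mk⇔ (λ u∈Z → proj₂ (∈-filter⁻ (T? ∘ inH) {xs = allStrings h} u∈Z))
                 (∈-filter⁺ (T? ∘ inH) (allStrings-complete u))

  -- Strings below Z are vertices of G, since Z ⊆ V(G) and V(G) is down-closed.
  belowZ⇒belowX : (u : B^ h) → T (belowSome u Z) → T (belowSome u X)
  belowZ⇒belowX u p =
    let s , s∈Z , u≼s = Equivalence.to (belowSome⇔ u Z) p
        sX , _        = Equivalence.to T-guarded (Equivalence.to (∈Z⇔inH s) s∈Z)
    in belowSome-downward u s X u≼s sX

  -- Strings below Z are exactly the vertices of H: this is where the
  -- ≤-subgraph hypothesis (V(H) down-closed in G) enters.
  belowZ⇔inH : (u : B^ h) → T (belowSome u Z) ⇔ T (inH u)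
  belowZ⇔inH u = mk⇔ to from
    where
    to : T (belowSome u Z) → T (inH u)
    to p =
      let s , s∈Z , u≼s = Equivalence.to (belowSome⇔ u Z) p
          sX , sH       = Equivalence.to T-guarded (Equivalence.to (∈Z⇔inH s) s∈Z)
          uX            = belowZ⇒belowX u p
      in Equivalence.from T-guarded
           (uX , Equivalence.from (isSub (u , uX)) ((s , sX) , sH , u≼s))
    from : T (inH u) → T (belowSome u Z)
    from uH = Equivalence.from (belowSome⇔ u Z)
                (u , Equivalence.from (∈Z⇔inH u) uH , ≼-refl u)

  layer₀ : (u : B^ h) → belowSome (false ∷ᵥ u) Y ≡ belowSome u X ∨ belowSome u Z
  layer₀ u = begin
    belowSome (false ∷ᵥ u) Y
      ≡⟨ belowSome-++ (false ∷ᵥ u) (map (false ∷ᵥ_) X) (map (true ∷ᵥ_) Z) ⟩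
    belowSome (false ∷ᵥ u) (map (false ∷ᵥ_) X) ∨ belowSome (false ∷ᵥ u) (map (true ∷ᵥ_) Z)
      ≡⟨ cong₂ _∨_ (belowSome-prefix false false u X) (belowSome-prefix false true u Z) ⟩
    belowSome u X ∨ belowSome u Z
      ∎
    where open ≡-Reasoning

  layer₁ : (u : B^ h) → belowSome (true ∷ᵥ u) Y ≡ belowSome u Z
  layer₁ u = begin
    belowSome (true ∷ᵥ u) Y
      ≡⟨ belowSome-++ (true ∷ᵥ u) (map (false ∷ᵥ_) X) (map (true ∷ᵥ_) Z) ⟩
    belowSome (true ∷ᵥ u) (map (false ∷ᵥ_) X) ∨ belowSome (true ∷ᵥ u) (map (true ∷ᵥ_) Z)
      ≡⟨ cong₂ _∨_ (belowSome-prefix true false u X) (belowSome-prefix true true u Z) ⟩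
    belowSome u Z
      ∎
    where open ≡-Reasoning

  layer₀-vertex : (u : B^ h) → T (belowSome (false ∷ᵥ u) Y) ⇔ T (belowSome u X)
  layer₀-vertex u = mk⇔ to from
    where
    to : T (belowSome (false ∷ᵥ u) Y) → T (belowSome u X)
    to p with Equivalence.to (T-∨ {belowSome u X}) (subst T (layer₀ u) p)
    ... | inj₁ uX = uX
    ... | inj₂ uZ = belowZ⇒belowX u uZ
    from : T (belowSome u X) → T (belowSome (false ∷ᵥ u) Y)
    from uX = subst T (sym (layer₀ u)) (Equivalence.from (T-∨ {belowSome u X}) (inj₁ uX))

  layer₁-vertex : (u : B^ h) →
                  T (belowSome (true ∷ᵥ u) Y) ⇔ Σ (T (belowSome u X)) (λ p → T (S (u , p)))
  layer₁-vertex u = mk⇔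
    (λ p → Equivalence.to T-guarded (Equivalence.to (belowZ⇔inH u) (subst T (layer₁ u) p)))
    (λ q → subst T (sym (layer₁ u)) (Equivalence.from (belowZ⇔inH u) (Equivalence.from T-guarded q)))

  embed : V (pe G S) → V (Daisy (suc h) Y)
  embed (inj₁ (u , p))       = false ∷ᵥ u , Equivalence.from (layer₀-vertex u) p
  embed (inj₂ ((u , p) , q)) = true ∷ᵥ u , Equivalence.from (layer₁-vertex u) (p , q)

  unembed : V (Daisy (suc h) Y) → V (pe G S)
  unembed (false ∷ᵥ u , r) = inj₁ (u , Equivalence.to (layer₀-vertex u) r)
  unembed (true ∷ᵥ u , r)  = inj₂ ((u , proj₁ pq) , proj₂ pq)
    where pq = Equivalence.to (layer₁-vertex u) r

  embed-unembed : ∀ w → embed (unembed w) ≡ w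
  embed-unembed (false ∷ᵥ u , r) = Σ-T-≡ refl
  embed-unembed (true ∷ᵥ u , r)  = Σ-T-≡ refl

  unembed-embed : ∀ a → unembed (embed a) ≡ a
  unembed-embed (inj₁ _) = cong inj₁ (Σ-T-≡ refl)
  unembed-embed (inj₂ _) = cong inj₂ (Σ-T-≡ (Σ-T-≡ refl))

  vertex-bijection : V (pe G S) ↔ V (Daisy (suc h) Y)
  vertex-bijection = mk↔ₛ′ embed unembed embed-unembed unembed-embed

  -- A rung edge v v' becomes 0v ~ 1v: strings differing in the first bit
  -- are adjacent iff they agree in all other bits.
  rung : (a b : V G) → a ≡ b ⇔ suc (hamming (proj₁ a) (proj₁ b)) ≡ 1
  rung a b = mk⇔ (cong suc ∘ Equivalence.to (daisy-≡⇔hamming-zero {X = X} a b))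
                 (Equivalence.from (daisy-≡⇔hamming-zero {X = X} a b) ∘ suc-injective)

  -- Edges inside a layer keep their Hamming distance, so only the rungs
  -- need an argument.
  adjacency : ∀ a b → Adj (pe G S) a b ⇔ Adj (Daisy (suc h) Y) (embed a) (embed b)
  adjacency (inj₁ _)       (inj₁ _)       = mk⇔ (λ e → e) (λ e → e)
  adjacency (inj₂ _)       (inj₂ _)       = mk⇔ (λ e → e) (λ e → e)
  adjacency (inj₁ a)       (inj₂ (b , _)) = rung a b
  adjacency (inj₂ (a , _)) (inj₁ b)       = rung a b

proposition2p7 : (h : ℕ) (X : List (B^ h)) (S : V (Daisy h X) → Bool) →
                 Is≤Subgraph h X S → IsDaisyCube (pe (Daisy h X) S)
proposition2p7 h X S isSub = suc h , Y , vertex-bijection , adjacency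
  where open Expansion h X S isSub
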